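{- Let $\cong$ be a congruence on a double-suited IFG$_N$-algebra $\mathbf C$. If two elements of $\mathbf C$ of different order are congruent, then $\cong$ is the total congruence.
   Context: Let $A$ be a set and $N\in\mathbb N$, identified with $\{0,\dots,N-1\}$; ${}^NA$ is the set of valuations $\vec a=(a_0,\dots,a_{N-1})$; a team is a subset of ${}^NA$. For $J\subseteq N$, $\vec a\approx_J\vec b$ means they agree on $N\setminus J$. $V=V_1\cup_J V_2$ means $V_1\cup V_2=V$, $V_1\cap V_2=\emptyset$, and each $V_i$ is closed under $\approx_J$ within $V$. $f:V\to A$ is independent of $J$ if $f(\vec a)=f(\vec b)$ whenever $\vec a\approx_J\vec b$. $\vec a(n:b)$ is $\vec a$ with $n$th coordinate replaced by $b$; $V(n:f)=\{\vec a(n:f(\vec a)):\vec a\in V\}$; $W(n:A)=\{\vec a(n:b):\vec a\in W,b\in A\}$. The IFG-cylindric power set algebra with base set $A$ and dimension $N$ has universe $\mathcal P(\mathcal P({}^NA))\times\mathcal P(\mathcal P({}^NA))$, elements written $X=\langle X^+,X^-\rangle$, and operations: $0=\langle\{\emptyset\},\mathcal P({}^NA)\rangle$, $1=\langle\mathcal P({}^NA),\{\emptyset\}\rangle$, $D_{ij}=\langle\mathcal P(\{\vec a:a_i=a_j\}),\mathcal P(\{\vec a:a_i\neq a_j\})\rangle$ ($i,j<N$); $\neg X=\langle X^-,X^+\rangle$; for $J\subseteq N$: $(X+_JY)^+=\{V:V=V_1\cup_JV_2,\ V_1\in X^+,V_2\in Y^+\}$, $(X+_JY)^-=X^-\cap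 Y^-$; $(X\cdot_JY)^+=X^+\cap Y^+$, $(X\cdot_JY)^-=\{W:W=W_1\cup_JW_2,\ W_1\in X^-,W_2\in Y^-\}$; for $n<N$, $J\subseteq N$: $C_{n,J}(X)^+=\{V:V(n:f)\in X^+$ for some $f:V\to A$ independent of $J\}$, $C_{n,J}(X)^-=\{W:W(n:A)\in X^-\}$. An IFG$_N$-algebra is a subalgebra of such an algebra. A suit is a nonempty set of teams closed under subsets; a double suit is a pair of suits $\langle X^+,X^-\rangle$ with $X^+\cap X^-=\{\emptyset\}$; an IFG-algebra is double-suited if all its elements are double suits. For an element $X$ and positive integer $n$, $nX$ denotes $X+_\emptyset X+_\emptyset\cdots+_\emptyset X$ ($n$ copies). The order of $X$ is the least positive integer $n$ with $nX=1$, and is infinite if no such $n$ exists. A congruence is an equivalence relation preserved by all operations; the total congruence relates every pair of elements. -}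

module Defs where

open import Level using (Level; Lift; _⊔_) renaming (suc to lsuc; zero to lzero)
open import Data.Nat using (ℕ; zero; suc; _≤_; _<_)
open import Data.Fin using (Fin)
open import Data.Fin.Subset using (Subset; _∉_; ⊥)
open import Data.Vec using (Vec; lookup; _[_]≔_)
open import Data.Maybe using (Maybe; just; nothing)
open import Data.Product using (Σ; _×_; _,_)
open import Data.Sum using (_⊎_)
open import Data.Unit using (⊤)
open import Data.Empty renaming (⊥ to Empty)
open import Relation.Nullary using (¬_)
open import Relation.Binary.PropositionalEquality using (_≡_)

-- The IFG-cylindric power set algebra with base set A and dimension N.
module IFG (A : Set) (N : ℕ) where

  -- valuations  ^N A  (vectors, so that equality of valuations is the usual one)
  Val : Set
  Val = Vec A N

  Team : Set₁
  Team = Val → Set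

  TeamSet : Set₂
  TeamSet = Team → Set₁

  -- elements X = ⟨X⁺ , X⁻⟩
  record Elem : Set₂ where
    constructor ⟨_,_⟩
    field
      pos : TeamSet
      neg : TeamSet
  open Elem public

  _⊆ᵗ_ : Team → Team → Set
  V ⊆ᵗ W = ∀ a → V a → W a

  IsEmpty : Team → Set
  IsEmpty V = ∀ a → ¬ V a

  Pow : Team → TeamSet
  Pow S V = Lift (lsuc lzero) (V ⊆ᵗ S)

  Sing∅ : TeamSet
  Sing∅ V = Lift (lsuc lzero) (IsEmpty V)

  _≈[_]_ : Val → Subset N → Val → Set
  a ≈[ J ] b = ∀ i → i ∉ J → lookup a i ≡ lookup b i

  Split : Subset N → Team → Team → Team → Set
  Split J V V₁ V₂ =
      (∀ a → V₁ a → V a) × (∀ a → V₂ a → V a) × (∀ a → V a → V₁ a ⊎ V₂ a)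
    × (∀ a → V₁ a → V₂ a → Empty)
    × (∀ a b → V₁ a → V b → a ≈[ J ] b → V₁ b)
    × (∀ a b → V₂ a → V b → a ≈[ J ] b → V₂ b)

  Independent : Subset N → (V : Team) → ((a : Val) → V a → A) → Set
  Independent J V f = ∀ a b (p : V a) (q : V b) → a ≈[ J ] b → f a p ≡ f b q

  assign : (V : Team) → Fin N → ((a : Val) → V a → A) → Team
  assign V n f b = Σ Val (λ a → Σ (V a) (λ p → b ≡ (a [ n ]≔ f a p)))

  cyl : Team → Fin N → Team
  cyl W n b = Σ Val (λ a → W a × Σ A (λ c → b ≡ (a [ n ]≔ c)))

  0ₑ : Elem
  0ₑ = ⟨ Sing∅ , Pow (λ _ → ⊤) ⟩

  1ₑ : Elem
  1ₑ = ⟨ Pow (λ _ → ⊤) , Sing∅ ⟩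

  D : Fin N → Fin N → Elem
  D i j = ⟨ Pow (λ a → lookup a i ≡ lookup a j) , Pow (λ a → ¬ (lookup a i ≡ lookup a j)) ⟩

  ¬ₑ_ : Elem → Elem
  ¬ₑ X = ⟨ neg X , pos X ⟩

  _+[_]_ : Elem → Subset N → Elem → Elem
  X +[ J ] Y = ⟨ (λ V → Σ Team (λ V₁ → Σ Team (λ V₂ → Split J V V₁ V₂ × pos X V₁ × pos Y V₂)))
               , (λ W → neg X W × neg Y W) ⟩

  _·[_]_ : Elem → Subset N → Elem → Elem
  X ·[ J ] Y = ⟨ (λ V → pos X V × pos Y V)
               , (λ W → Σ Team (λ W₁ → Σ Team (λ W₂ → Split J W W₁ W₂ × neg X W₁ × neg Y W₂))) ⟩

  C : Fin N → Subset N → Elem → Elem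
  C n J X = ⟨ (λ V → Σ ((a : Val) → V a → A) (λ f → Independent J V f × pos X (assign V n f)))
            , (λ W → neg X (cyl W n)) ⟩

  _≐_ : Elem → Elem → Set₁
  X ≐ Y = (∀ V → (pos X V → pos Y V) × (pos Y V → pos X V))
        × (∀ V → (neg X V → neg Y V) × (neg Y V → neg X V))

  record IsSubalgebra {ℓ : Level} (S : Elem → Set ℓ) : Set (lsuc (lsuc lzero) ⊔ ℓ) where
    field
      resp : ∀ {X Y} → X ≐ Y → S X → S Y
      has0 : S 0ₑ
      has1 : S 1ₑ
      hasD : ∀ i j → S (D i j)
      cl¬  : ∀ {X} → S X → S (¬ₑ X)
      cl+  : ∀ J {X Y} → S X → S Y → S (X +[ J ] Y)
      cl·  : ∀ J {X Y} → S X → S Y → S (X ·[ J ] Y)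
      clC  : ∀ n J {X} → S X → S (C n J X)

  IsSuit : TeamSet → Set₁
  IsSuit X = Σ Team X × (∀ V W → X V → W ⊆ᵗ V → X W)

  IsDoubleSuit : Elem → Set₁
  IsDoubleSuit X = IsSuit (pos X) × IsSuit (neg X)
                 × (∀ V → (pos X V × neg X V → IsEmpty V) × (IsEmpty V → pos X V × neg X V))

  DoubleSuited : {ℓ : Level} → (Elem → Set ℓ) → Set (lsuc (lsuc lzero) ⊔ ℓ)
  DoubleSuited S = ∀ X → S X → IsDoubleSuit X

  record IsCongruence {ℓ ℓ' : Level} (S : Elem → Set ℓ) (R : Elem → Elem → Set ℓ')
         : Set (lsuc (lsuc lzero) ⊔ ℓ ⊔ ℓ') where
    field
      refl≐ : ∀ {X Y} → S X → S Y → X ≐ Y → R X Y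
      sym   : ∀ {X Y} → S X → S Y → R X Y → R Y X
      trans : ∀ {X Y Z} → S X → S Y → S Z → R X Y → R Y Z → R X Z
      pres¬ : ∀ {X X'} → S X → S X' → R X X' → R (¬ₑ X) (¬ₑ X')
      pres+ : ∀ J {X X' Y Y'} → S X → S X' → S Y → S Y' →
              R X X' → R Y Y' → R (X +[ J ] Y) (X' +[ J ] Y')
      pres· : ∀ J {X X' Y Y'} → S X → S X' → S Y → S Y' →
              R X X' → R Y Y' → R (X ·[ J ] Y) (X' ·[ J ] Y')
      presC : ∀ n J {X X'} → S X → S X' → R X X' → R (C n J X) (C n J X')

  IsTotal : {ℓ ℓ' : Level} (S : Elem → Set ℓ) (R : Elem → Elem → Set ℓ') → Set (lsuc (lsuc lzero) ⊔ ℓ ⊔ ℓ')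
  IsTotal S R = ∀ X Y → S X → S Y → R X Y

  -- nX = X +_∅ X +_∅ ... +_∅ X  (n copies, n ≥ 1); 0 copies is never used
  copies : ℕ → Elem → Elem
  copies zero X = 0ₑ
  copies (suc zero) X = X
  copies (suc (suc n)) X = X +[ ⊥ ] copies (suc n) X

  -- HasOrder X (just n) : the order of X is n ;  HasOrder X nothing : the order is infinite
  HasOrder : Elem → Maybe ℕ → Set₁
  HasOrder X (just n) = (1 ≤ n) × (copies n X ≐ 1ₑ) × (∀ m → 1 ≤ m → m < n → ¬ (copies m X ≐ 1ₑ))
  HasOrder X nothing = ∀ m → 1 ≤ m → ¬ (copies m X ≐ 1ₑ)

module Submission where

-- If X ≅ Y and their orders differ, then for some m ≥ 1 one of mX, mY
-- equals 1 and the other does not; as ≅ respects +_∅, we get Z ≅ 1 for an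
-- element Z ≠ 1 of the algebra.  Quantifying universally over all
-- coordinates, E = ∀x₀…∀x_{N-1} Z is still ≅ 1, and E⁺ contains only the
-- empty team: a nonempty team in E⁺ would force the full team into Z⁺, i.e.
-- Z = 1 for a double suit.  Such an E satisfies E = E ·_∅ ¬E, hence
-- E ≅ 1 ·_∅ ¬1 = 0, so 0 ≅ 1; and then every X = X +_∅ 0 ≅ X +_∅ 1 = 1.

open import Defs
open import Level using (Level; lift; lower)
open import Data.Nat using (ℕ; zero; suc)
open import Data.Nat.Properties using (<-cmp)
open import Data.Maybe using (Maybe; just; nothing)
open import Data.Fin using (Fin)
open import Data.Fin.Properties using (_≟_)
open import Data.Fin.Subset using (Subset; ⊥)
open import Data.Vec using (lookup; _[_]≔_)
open import Data.Vec.Properties using (lookup∘update; lookup∘update′)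
open import Data.Vec.Relation.Binary.Pointwise.Extensional using (ext; Pointwise-≡⇒≡)
open import Data.List using (List; []; _∷_; allFin)
open import Data.List.Membership.Propositional using (_∈_)
open import Data.List.Membership.Propositional.Properties using (∈-allFin)
open import Data.List.Relation.Unary.Any using (here; there)
open import Data.Product using (Σ; _×_; _,_; proj₁; proj₂)
open import Data.Sum using (_⊎_; inj₁; inj₂)
open import Data.Unit using (⊤; tt)
open import Data.Empty renaming (⊥ to Empty) using (⊥-elim)
open import Relation.Nullary using (¬_; yes; no)
open import Relation.Binary using (tri<; tri≈; tri>)
open import Relation.Binary.PropositionalEquality using (_≡_; refl; subst) renaming (trans to ≡-trans)

module _ (A : Set) (N : ℕ) where
  open IFG A N

  ≐-refl : ∀ {X} → X ≐ X
  ≐-refl = (λ V → (λ p → p) , (λ p → p)) , (λ V → (λ p → p) , (λ p → p))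

  ≐-sym : ∀ {X Y} → X ≐ Y → Y ≐ X
  ≐-sym (p , n) = (λ V → proj₂ (p V) , proj₁ (p V)) , (λ V → proj₂ (n V) , proj₁ (n V))

  module DoubleSuit {X : Elem} (d : IsDoubleSuit X) where
    pos-down : ∀ V W → pos X V → W ⊆ᵗ V → pos X W
    pos-down = proj₂ (proj₁ d)

    neg-down : ∀ V W → neg X V → W ⊆ᵗ V → neg X W
    neg-down = proj₂ (proj₁ (proj₂ d))

    empty-in-both : ∀ V → IsEmpty V → pos X V × neg X V
    empty-in-both V = proj₂ (proj₂ (proj₂ d) V)

    pos∩neg-empty : ∀ V → pos X V → neg X V → IsEmpty V
    pos∩neg-empty V p n = proj₁ (proj₂ (proj₂ d) V) (p , n)

  ∅ᵗ : Team
  ∅ᵗ _ = Empty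

  split-left : ∀ J V → Split J V V ∅ᵗ
  split-left J V = (λ a p → p) , (λ a ()) , (λ a p → inj₁ p) , (λ a _ ()) , (λ a b _ q _ → q) , (λ a b ())

  split-right : ∀ J V → Split J V ∅ᵗ V
  split-right J V = (λ a ()) , (λ a p → p) , (λ a p → inj₂ p) , (λ a ()) , (λ a b ()) , (λ a b _ q _ → q)

  split-rest : ∀ {J V V₁ V₂} → Split J V V₁ V₂ → IsEmpty V₂ → V ⊆ᵗ V₁
  split-rest (_ , _ , cover , _) V₂-empty a v with cover a v
  ... | inj₁ v₁ = v₁
  ... | inj₂ v₂ = ⊥-elim (V₂-empty a v₂)

  +-identityʳ : ∀ {X} J → IsDoubleSuit X → X ≐ (X +[ J ] 0ₑ)
  +-identityʳ {X} J d =
      (λ V → (λ p → V , ∅ᵗ , split-left J V , p , lift (λ a ()))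
           , (λ { (V₁ , V₂ , s , p , lift V₂-empty) → pos-down V₁ V p (split-rest s V₂-empty) }))
    , (λ W → (λ w → w , lift (λ _ _ → tt)) , proj₁)
    where open DoubleSuit d

  +-zeroʳ : ∀ {X} J → IsDoubleSuit X → (X +[ J ] 1ₑ) ≐ 1ₑ
  +-zeroʳ J d =
      (λ V → (λ _ → lift (λ _ _ → tt))
           , (λ _ → ∅ᵗ , V , split-right J V , proj₁ (empty-in-both ∅ᵗ (λ a ())) , lift (λ _ _ → tt)))
    , (λ W → proj₂ , (λ { (lift W-empty) → proj₂ (empty-in-both W W-empty) , lift W-empty }))
    where open DoubleSuit d

  -- A double suit E whose positive part contains only the empty team satisfies
  -- E = E ·_J ¬E: positively since (¬E)⁺ = E⁻ contains every empty team, and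
  -- negatively since a split of W into W₁ ∈ E⁻ and W₂ ∈ (¬E)⁻ = E⁺ has W₂ = ∅.
  ·-self-negation : ∀ {E} J → IsDoubleSuit E → (∀ V → pos E V → IsEmpty V) → E ≐ (E ·[ J ] (¬ₑ E))
  ·-self-negation {E} J d E⁺-empty =
      (λ V → (λ p → p , proj₂ (empty-in-both V (E⁺-empty V p))) , proj₁)
    , (λ W → (λ w → W , ∅ᵗ , split-left J W , w , proj₁ (empty-in-both ∅ᵗ (λ a ())))
           , (λ { (W₁ , W₂ , s , w₁ , p) → neg-down W₁ W w₁ (split-rest s (E⁺-empty W₂ p)) }))
    where open DoubleSuit d

  1·¬1≐0 : ∀ J → (1ₑ ·[ J ] (¬ₑ 1ₑ)) ≐ 0ₑ
  1·¬1≐0 J =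
      (λ V → proj₂ , (λ V-empty → lift (λ _ _ → tt) , V-empty))
    , (λ W → (λ _ → lift (λ _ _ → tt))
           , (λ _ → ∅ᵗ , W , split-right J W , lift (λ a ()) , lift (λ _ _ → tt)))

  full-team⇒one : ∀ {Z} → IsDoubleSuit Z → pos Z (λ _ → ⊤) → Z ≐ 1ₑ
  full-team⇒one {Z} d full =
      (λ V → (λ _ → lift (λ _ _ → tt)) , (λ _ → pos-down _ V full (λ _ _ → tt)))
    , (λ W → (λ W∈Z⁻ → lift (pos∩neg-empty W (pos-down _ W full (λ _ _ → tt)) W∈Z⁻))
           , (λ { (lift W-empty) → proj₂ (empty-in-both W W-empty) }))
    where open DoubleSuit d

  -- Universal quantification ∀x_n = ¬ C_{n,J} ¬ ; its positive part is read
  -- off the cylindrified team:  V ∈ (∀ₑ n J X)⁺  iff  V(n:A) ∈ X⁺.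
  ∀ₑ : Fin N → Subset N → Elem → Elem
  ∀ₑ n J X = ¬ₑ (C n J (¬ₑ X))

  from-empty : (V : Team) → IsEmpty V → (a : Val) → V a → A
  from-empty V V-empty a v = ⊥-elim (V-empty a v)

  -- Quantifying 1 gives 1: (C ¬1)⁺ holds only of teams whose images V(n:f)
  -- are empty, i.e. of empty teams.
  ∀ₑ-one : ∀ {X} n J → X ≐ 1ₑ → ∀ₑ n J X ≐ 1ₑ
  ∀ₑ-one {X} n J (X⁺≐ , X⁻≐) =
      (λ V → (λ _ → lift (λ _ _ → tt)) , (λ _ → proj₂ (X⁺≐ (cyl V n)) (lift (λ _ _ → tt))))
    , (λ W → (λ { (f , _ , fW∈X⁻) → lift (λ a w → lower (proj₁ (X⁻≐ (assign W n f)) fW∈X⁻) _ (a , w , refl)) })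
           , (λ { (lift W-empty) →
                    from-empty W W-empty
                  , (λ a _ w _ _ → ⊥-elim (W-empty a w))
                  , proj₂ (X⁻≐ (assign W n (from-empty W W-empty)))
                          (lift (λ { _ (a , w , _) → W-empty a w })) }))

  ∀* : Subset N → List (Fin N) → Elem → Elem
  ∀* J [] X = X
  ∀* J (n ∷ ns) X = ∀ₑ n J (∀* J ns X)

  cyl* : List (Fin N) → Team → Team
  cyl* [] V = V
  cyl* (n ∷ ns) V = cyl* ns (cyl V n)

  ∀*-pos : ∀ J L X V → pos (∀* J L X) V → pos X (cyl* L V)
  ∀*-pos J [] X V p = p
  ∀*-pos J (n ∷ ns) X V p = ∀*-pos J ns X (cyl V n) p

  ∀*-one : ∀ J L → ∀* J L 1ₑ ≐ 1ₑ
  ∀*-one J [] = ≐-refl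
  ∀*-one J (n ∷ ns) = ∀ₑ-one n J (∀*-one J ns)

  cyl*-covers : ∀ L (V : Team) {a b} → V a → (∀ j → ¬ j ∈ L → lookup a j ≡ lookup b j) → cyl* L V b
  cyl*-covers [] V v agree = subst V (Pointwise-≡⇒≡ (ext (λ j → agree j (λ ())))) v
  cyl*-covers (n ∷ ns) V {a} {b} v agree = cyl*-covers ns (cyl V n) (a , v , lookup b n , refl) agree′
    where
    agree′ : ∀ j → ¬ j ∈ ns → lookup (a [ n ]≔ lookup b n) j ≡ lookup b j
    agree′ j j∉ns with j ≟ n
    ... | yes refl = lookup∘update n a (lookup b n)
    ... | no j≢n = ≡-trans (lookup∘update′ j≢n a (lookup b n))
                           (agree j (λ { (here j≡n) → j≢n j≡n ; (there j∈ns) → j∉ns j∈ns }))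

  cyl*-all : ∀ (V : Team) {a} → V a → (λ _ → ⊤) ⊆ᵗ cyl* (allFin N) V
  cyl*-all V v b _ = cyl*-covers (allFin N) V v (λ j j∉ → ⊥-elim (j∉ (∈-allFin j)))

  Separates : Elem → Elem → Set₁
  Separates X Y = Σ ℕ (λ m → (copies m X ≐ 1ₑ) × ¬ (copies m Y ≐ 1ₑ))

  orders-separate : ∀ {X Y} o₁ o₂ → HasOrder X o₁ → HasOrder Y o₂ → ¬ (o₁ ≡ o₂) →
                    Separates X Y ⊎ Separates Y X
  orders-separate (just m) (just n) (1≤m , mX≐1 , below-m) (1≤n , nY≐1 , below-n) m≢n with <-cmp m n
  ... | tri< m<n _ _ = inj₁ (m , mX≐1 , below-n m 1≤m m<n)
  ... | tri≈ _ refl _ = ⊥-elim (m≢n refl)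
  ... | tri> _ _ n<m = inj₂ (n , nY≐1 , below-m n 1≤n n<m)
  orders-separate (just m) nothing (1≤m , mX≐1 , _) never-Y _ = inj₁ (m , mX≐1 , never-Y m 1≤m)
  orders-separate nothing (just n) never-X (1≤n , nY≐1 , _) _ = inj₂ (n , nY≐1 , never-X n 1≤n)
  orders-separate nothing nothing _ _ ∞≢∞ = ⊥-elim (∞≢∞ refl)

  module Congruence {ℓ ℓ' : Level} (S : Elem → Set ℓ) (sub : IsSubalgebra S) (ds : DoubleSuited S)
                    (R : Elem → Elem → Set ℓ') (cg : IsCongruence S R) where
    open IsSubalgebra sub
    open IsCongruence cg

    total-via-one : (∀ X → S X → R X 1ₑ) → IsTotal S R
    total-via-one to-one X Y sX sY = trans sX has1 sY (to-one X sX) (sym sY has1 (to-one Y sY))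

    -- 0 ≅ 1 forces totality:  X ≐ X + 0 ≅ X + 1 ≐ 1.
    zero≅one⇒total : R 0ₑ 1ₑ → IsTotal S R
    zero≅one⇒total r = total-via-one to-one
      where
      to-one : ∀ X → S X → R X 1ₑ
      to-one X sX =
        trans sX sX+0 has1 (refl≐ sX sX+0 (+-identityʳ ⊥ (ds X sX)))
          (trans sX+0 sX+1 has1 (pres+ ⊥ sX sX has0 has1 (refl≐ sX sX ≐-refl) r)
             (refl≐ sX+1 has1 (+-zeroʳ ⊥ (ds X sX))))
        where
        sX+0 = cl+ ⊥ sX has0
        sX+1 = cl+ ⊥ sX has1

    -- E ≅ 1 with E⁺ = {∅} forces totality:  0 ≐ 1 · ¬1 ≅ E · ¬E ≐ E ≅ 1.
    empty-pos≅one⇒total : ∀ E → S E → R E 1ₑ → (∀ V → pos E V → IsEmpty V) → IsTotal S R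
    empty-pos≅one⇒total E sE r E⁺-empty =
      zero≅one⇒total
        (trans has0 s1·¬1 has1 (refl≐ has0 s1·¬1 (≐-sym (1·¬1≐0 ⊥)))
          (trans s1·¬1 sE·¬E has1
             (pres· ⊥ has1 sE (cl¬ has1) (cl¬ sE) (sym sE has1 r) (pres¬ has1 sE (sym sE has1 r)))
             (trans sE·¬E sE has1 (refl≐ sE·¬E sE (≐-sym (·-self-negation ⊥ (ds E sE) E⁺-empty))) r)))
      where
      s1·¬1 = cl· ⊥ has1 (cl¬ has1)
      sE·¬E = cl· ⊥ sE (cl¬ sE)

    ∀*-closed : ∀ L {X} → S X → S (∀* ⊥ L X)
    ∀*-closed [] sX = sX
    ∀*-closed (n ∷ ns) sX = cl¬ (clC n ⊥ (cl¬ (∀*-closed ns sX)))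

    ∀*-compatible : ∀ L {X Y} → S X → S Y → R X Y → R (∀* ⊥ L X) (∀* ⊥ L Y)
    ∀*-compatible [] sX sY r = r
    ∀*-compatible (n ∷ ns) sX sY r =
      pres¬ (clC n ⊥ (cl¬ s∀X)) (clC n ⊥ (cl¬ s∀Y))
        (presC n ⊥ (cl¬ s∀X) (cl¬ s∀Y) (pres¬ s∀X s∀Y (∀*-compatible ns sX sY r)))
      where
      s∀X = ∀*-closed ns sX
      s∀Y = ∀*-closed ns sY

    -- Z ≅ 1 with Z ≠ 1 forces totality, via E = ∀x₀…∀x_{N-1} Z: a nonempty
    -- V ∈ E⁺ would put the full team V(N:A) into Z⁺.
    non-one≅one⇒total : ∀ Z → S Z → R Z 1ₑ → ¬ (Z ≐ 1ₑ) → IsTotal S R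
    non-one≅one⇒total Z sZ r Z≠1 = empty-pos≅one⇒total E sE E≅1 E⁺-empty
      where
      L = allFin N
      E = ∀* ⊥ L Z
      sE = ∀*-closed L sZ
      s∀1 = ∀*-closed L has1
      E≅1 : R E 1ₑ
      E≅1 = trans sE s∀1 has1 (∀*-compatible L sZ has1 r) (refl≐ s∀1 has1 (∀*-one ⊥ L))
      E⁺-empty : ∀ V → pos E V → IsEmpty V
      E⁺-empty V p a v =
        Z≠1 (full-team⇒one (ds Z sZ)
               (DoubleSuit.pos-down (ds Z sZ) (cyl* L V) _ (∀*-pos ⊥ L Z V p) (cyl*-all V v)))

    copies-closed : ∀ m {X} → S X → S (copies m X)
    copies-closed zero sX = has0
    copies-closed (suc zero) sX = sX
    copies-closed (suc (suc m)) sX = cl+ ⊥ sX (copies-closed (suc m) sX)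

    copies-compatible : ∀ m {X Y} → S X → S Y → R X Y → R (copies m X) (copies m Y)
    copies-compatible zero sX sY r = refl≐ has0 has0 ≐-refl
    copies-compatible (suc zero) sX sY r = r
    copies-compatible (suc (suc m)) sX sY r =
      pres+ ⊥ sX sY (copies-closed (suc m) sX) (copies-closed (suc m) sY) r (copies-compatible (suc m) sX sY r)

    -- If mX = 1 ≠ mY and X ≅ Y, then mY ≅ mX = 1 with mY ≠ 1.
    separated≅⇒total : ∀ {X Y} → S X → S Y → R X Y → Separates X Y → IsTotal S R
    separated≅⇒total sX sY r (m , mX≐1 , mY≠1) =
      non-one≅one⇒total _ smY
        (trans smY smX has1 (sym smX smY (copies-compatible m sX sY r)) (refl≐ smX has1 mX≐1))
        mY≠1
      where
      smX = copies-closed m sX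
      smY = copies-closed m sY

    separation≅⇒total : ∀ {X Y} → S X → S Y → R X Y → Separates X Y ⊎ Separates Y X → IsTotal S R
    separation≅⇒total sX sY r (inj₁ sep-XY) = separated≅⇒total sX sY r sep-XY
    separation≅⇒total sX sY r (inj₂ sep-YX) = separated≅⇒total sY sX (sym sX sY r) sep-YX

mainTheorem15 : {ℓ ℓ' : Level} (A : Set) (N : ℕ) →
    let open IFG A N in
    (S : Elem → Set ℓ) → IsSubalgebra S → DoubleSuited S →
    (R : Elem → Elem → Set ℓ') → IsCongruence S R →
    (X Y : Elem) → S X → S Y → (o₁ o₂ : Maybe ℕ) →
    HasOrder X o₁ → HasOrder Y o₂ → ¬ (o₁ ≡ o₂) → R X Y →
    IsTotal S R
mainTheorem15 A N S sub ds R cg X Y sX sY o₁ o₂ ord-X ord-Y o₁≢o₂ X≅Y =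
  separation≅⇒total sX sY X≅Y (orders-separate A N o₁ o₂ ord-X ord-Y o₁≢o₂)
  where open Congruence A N S sub ds R cg
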